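{- Let $G$ be a group equipped with the profinite topology. If $A\subseteq G$ is almost tree-founded, then $A$ has the strong Baire property with respect to the profinite topology.
   Context: The profinite topology on $G$ is generated by all cosets of subgroups of finite index. A set has the strong Baire property (SBP) if its boundary has empty interior, equivalently $\mathrm{int}(A)\cup\mathrm{int}(G\setminus A)$ is dense. Consider $(T,\mathcal H,d,v)$ where $T\subseteq\omega^{<\omega}$ is a finitely branching tree with leaves $T_L$, $H_\eta\le G$, $d_\eta\in G$ ($\eta\in T$), $v:T_L\to\{0,1\}$, such that $H_\varnothing=G$; $H_{\eta^\frown i}=H_{\eta^\frown j}$ whenever both nodes are in $T$; $H_{\eta^\frown i}$ is a proper finite-index subgroup of $H_\eta$; for non-leaves $\eta$, $d_\eta H_\eta$ is the disjoint union of the $d_{\eta^\frown i}H_{\eta^\frown i}$, $\eta^\frown i\in T$; and every $\eta\in T$ extends to a leaf (it is not assumed that leaf cosets cover $G$). Let $G_L=\bigcup_{\eta\in T_L}d_\eta H_\eta$ and $f_T:G_L\to T_L$ map $g$ to the unique leaf $\eta$ with $g\in d_\eta H_\eta$. $A$ is almost tree-founded if for some such tuple, $\chi_A\restriction G_L=v\circ f_T$. -}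

module Defs where

open import Level using (Level; _⊔_)
open import Algebra.Bundles using (Group)
open import Data.Nat using (ℕ; _<_)
open import Data.Bool using (Bool; true)
open import Data.List using (List; []; _∷_; _++_; [_])
open import Data.List.Relation.Unary.All using (All)
open import Data.List.Relation.Unary.Any using (Any)
open import Data.Product using (Σ; ∃; ∃-syntax; _×_; _,_)
open import Data.Empty using (⊥)
open import Relation.Nullary using (¬_)
open import Relation.Unary using (Pred)
open import Relation.Binary.PropositionalEquality using (_≡_; _≢_)

module GroupDefs {c ℓ : Level} (G : Group c ℓ) where
  open Group G

  Subset : Set (Level.suc (c ⊔ ℓ))
  Subset = Pred Carrier (c ⊔ ℓ)

  RespectsEq : ∀ {p} → Pred Carrier p → Set (c ⊔ ℓ ⊔ p)
  RespectsEq S = ∀ {x y} → x ≈ y → S x → S y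

  InCoset : Carrier → Subset → Carrier → Set (c ⊔ ℓ)
  InCoset d H x = H (d ⁻¹ ∙ x)

  record IsSubgroup (H : Subset) : Set (c ⊔ ℓ) where
    field
      resp  : RespectsEq H
      ε∈    : H ε
      ∙∈    : ∀ {x y} → H x → H y → H (x ∙ y)
      ⁻¹∈   : ∀ {x} → H x → H (x ⁻¹)

  _⊆_ : Subset → Subset → Set (c ⊔ ℓ)
  K ⊆ H = ∀ {x} → K x → H x

  FiniteIndexIn : Subset → Subset → Set (c ⊔ ℓ)
  FiniteIndexIn K H =
    Σ (List Carrier) λ rs → All H rs × (∀ {h} → H h → Any (λ r → InCoset r K h) rs)

  Full : Subset
  Full _ = Level.Lift (c ⊔ ℓ) Data.Unit.⊤
    where import Data.Unit

  FiniteIndexSubgroup : Subset → Set (c ⊔ ℓ)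
  FiniteIndexSubgroup K = IsSubgroup K × FiniteIndexIn K Full

  ProperFiniteIndexSubgroupOf : Subset → Subset → Set (c ⊔ ℓ)
  ProperFiniteIndexSubgroupOf K H =
    IsSubgroup K × K ⊆ H × FiniteIndexIn K H × (∃[ h ] (H h × ¬ K h))

  -- Profinite topology: generated by the cosets of finite-index subgroups.
  -- Since these cosets form a base (closed under finite intersection up to
  -- emptiness), U is open iff every point y ∈ U has a basic neighbourhood
  -- y K ⊆ U with K of finite index.

  IsOpen : Subset → Set (Level.suc (c ⊔ ℓ))
  IsOpen U = ∀ {y} → U y →
    Σ Subset λ K → FiniteIndexSubgroup K × (∀ {x} → InCoset y K x → U x)

  Interior : ∀ {p} → Pred Carrier p → Pred Carrier (Level.suc (c ⊔ ℓ) ⊔ p)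
  Interior S y = Σ Subset λ U → IsOpen U × U y × (∀ {x} → U x → S x)

  Compl : ∀ {p} → Pred Carrier p → Pred Carrier p
  Compl S x = ¬ S x

  Boundary : ∀ {p} → Pred Carrier p → Pred Carrier (Level.suc (c ⊔ ℓ) ⊔ p)
  Boundary S y = ¬ Interior S y × ¬ Interior (Compl S) y

  StrongBaire : ∀ {p} → Pred Carrier p → Set (Level.suc (c ⊔ ℓ) ⊔ p)
  StrongBaire S = ∀ y → ¬ Interior (Boundary S) y

  Node : Set
  Node = List ℕ

  _⁀_ : Node → ℕ → Node
  η ⁀ i = η ++ [ i ]

  record IsFBTree (T : Pred Node (c ⊔ ℓ)) : Set (c ⊔ ℓ) where
    field
      root       : T []
      prefixClosed : ∀ η i → T (η ⁀ i) → T η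
      finBranching : ∀ η → ∃[ n ] (∀ i → T (η ⁀ i) → i < n)

  IsLeaf : Pred Node (c ⊔ ℓ) → Node → Set (c ⊔ ℓ)
  IsLeaf T η = T η × (∀ i → ¬ T (η ⁀ i))

  record TreeData : Set (Level.suc (c ⊔ ℓ)) where
    field
      T : Pred Node (c ⊔ ℓ)
      H : Node → Subset
      d : Node → Carrier
      v : Node → Bool
      isTree      : IsFBTree T
      subgroup    : ∀ η → T η → IsSubgroup (H η)
      rootFull    : ∀ x → H [] x
      siblingsEq  : ∀ η i j → T (η ⁀ i) → T (η ⁀ j) →
                    ∀ x → (H (η ⁀ i) x → H (η ⁀ j) x) × (H (η ⁀ j) x → H (η ⁀ i) x)
      childProper : ∀ η i → T (η ⁀ i) → ProperFiniteIndexSubgroupOf (H (η ⁀ i)) (H η)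
      cover       : ∀ η → T η → ¬ IsLeaf T η → ∀ x →
                    (InCoset (d η) (H η) x → ∃[ i ] (T (η ⁀ i) × InCoset (d (η ⁀ i)) (H (η ⁀ i)) x))
                    × (∀ i → T (η ⁀ i) → InCoset (d (η ⁀ i)) (H (η ⁀ i)) x → InCoset (d η) (H η) x)
      disjoint    : ∀ η i j → T (η ⁀ i) → T (η ⁀ j) → i ≢ j → ∀ x →
                    InCoset (d (η ⁀ i)) (H (η ⁀ i)) x → InCoset (d (η ⁀ j)) (H (η ⁀ j)) x → ⊥
      toLeaf      : ∀ η → T η → ∃[ ζ ] IsLeaf T (η ++ ζ)

  -- A is almost tree-founded: χ_A ↾ G_L = v ∘ f_T, i.e. for every leaf η and
  -- every g ∈ d_η H_η (f_T g = η), g ∈ A iff v η = 1.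
  AlmostTreeFounded : ∀ {p} → Pred Carrier p → Set (Level.suc (c ⊔ ℓ) ⊔ p)
  AlmostTreeFounded A = Σ TreeData λ D → let open TreeData D in
    ∀ η → IsLeaf T η → ∀ g → InCoset (d η) (H η) g →
      (A g → v η ≡ true) × (v η ≡ true → A g)

{-# OPTIONS --safe #-}
-- Each leaf coset d_η H_η is open, as H_η has finite index in G, and lies inside A or inside
-- its complement, so it misses the boundary of A; it remains to see that every basic open set
-- y K meets some leaf coset. Walk down the tree through nodes ν whose coset meets y K, tracking
-- the set of left K-cosets met by H_ν. Moving to the child whose coset contains a point of y K
-- either shrinks this set, and we aim afresh at a leaf below that child, or keeps it; then
-- H_ν ⊆ H_{ν⁀i} K for every child ν⁀i, so every child coset meets y K and we may step towards
-- a fixed leaf. As K has finitely many cosets, a leaf is reached. Which case occurs is decided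
-- classically, which is harmless because the goal is ⊥.
module Submission where

open import Defs
open import Level using (Level; _⊔_)
open import Algebra.Bundles using (Group)
open import Relation.Unary using (Pred; Decidable)

open import Data.Bool using (true; false)
open import Data.Bool.Properties using (not-¬)
open import Data.Empty using (⊥)
open import Data.Nat using (ℕ)
open import Data.Fin using (Fin)
open import Data.Fin.Properties using (sequence)
open import Data.Fin.Subset as FinSubset using (_∈_; _⊆_; _⊂_)
open import Data.Fin.Subset.Induction using (⊂-wellFounded)
open import Data.Fin.Subset.Properties using (_∈?_; _⊂?_)
open import Data.List using (List; []; _∷_; _++_; [_]; length; lookup; concatMap; map)
open import Data.List.Properties using (++-identityʳ; ++-assoc)
open import Data.List.Relation.Unary.All using (universal)
open import Data.List.Relation.Unary.Any as Any using (Any; here)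
open import Data.List.Relation.Unary.Any.Properties using (lookup-index; concatMap⁺; map⁺)
open import Data.List.Reverse using (Reverse; reverseView; []; _∶_∶ʳ_)
open import Data.Product using (∃-syntax; _×_; _,_; proj₁; proj₂)
open import Data.Sum using (_⊎_; inj₁; inj₂)
open import Data.Vec using (tabulate)
open import Data.Vec.Properties using ([]=⇒lookup; lookup⇒[]=; lookup∘tabulate)
open import Effect.Monad using (RawMonad)
open import Function using (_∘_)
open import Function.Bundles using (_⇔_; mk⇔; Equivalence)
open import Induction.WellFounded using (Acc; acc)
open import Relation.Nullary using (¬_; yes; no; does)
open import Relation.Nullary.Decidable using (dec-true; decidable-stable; ¬¬-excluded-middle)
open import Relation.Nullary.Negation using (¬¬-map; ¬¬-Monad)
import Relation.Binary.PropositionalEquality as ≡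

open Equivalence using (to; from)

module _ {a : Level} {n : ℕ} where

  _Represents_ : FinSubset.Subset n → Pred (Fin n) a → Set a
  s Represents P = ∀ q → q ∈ s ⇔ P q

  fromDecidable : {P : Pred (Fin n) a} → Decidable P → FinSubset.Subset n
  fromDecidable P? = tabulate (does ∘ P?)

  fromDecidable-represents : {P : Pred (Fin n) a} (P? : Decidable P) → fromDecidable P? Represents P
  fromDecidable-represents {P} P? q = mk⇔ ∈⇒P P⇒∈
    where
    P⇒∈ : P q → q ∈ fromDecidable P?
    P⇒∈ p = lookup⇒[]= q _ (≡.trans (lookup∘tabulate _ q) (dec-true (P? q) p))

    ∈⇒P : q ∈ fromDecidable P? → P q
    ∈⇒P q∈ with P? q | ≡.trans (≡.sym (lookup∘tabulate (does ∘ P?) q)) ([]=⇒lookup q∈)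
    ... | yes p | _ = p
    ... | no _  | ()

  ¬¬-represented : (P : Pred (Fin n) a) → ¬ ¬ (∃[ s ] s Represents P)
  ¬¬-represented P = ¬¬-map (λ P? → fromDecidable P? , fromDecidable-represents P?)
    (sequence (RawMonad.rawApplicative ¬¬-Monad) (λ _ → ¬¬-excluded-middle))

⊆⇒⊂⊎⊇ : ∀ {n} {s t : FinSubset.Subset n} → s ⊆ t → s ⊂ t ⊎ t ⊆ s
⊆⇒⊂⊎⊇ {s = s} {t} s⊆t with s ⊂? t
... | yes s⊂t = inj₁ s⊂t
... | no  s⊄t = inj₂ λ {q} q∈t → decidable-stable (q ∈? s) (λ q∉s → s⊄t (s⊆t , q , q∈t , q∉s))

module Cosets {c ℓ : Level} (G : Group c ℓ) where
  open Group G
  open GroupDefs G using (Subset; RespectsEq; InCoset; IsSubgroup; Full; FiniteIndexIn; IsOpen)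
  open import Algebra.Properties.Group G using (\\-leftDividesˡ; \\-leftDividesʳ; ⁻¹-anti-homo-\\; ⁻¹-anti-homo-∙)
  open import Relation.Binary.Reasoning.Setoid setoid

  [x\\y]∙[y\\z]≈x\\z : ∀ x y z → (x \\ y) ∙ (y \\ z) ≈ x \\ z
  [x\\y]∙[y\\z]≈x\\z x y z = begin
    (x \\ y) ∙ (y \\ z)    ≈⟨ assoc (x ⁻¹) y (y \\ z) ⟩
    x ⁻¹ ∙ (y ∙ (y \\ z))  ≈⟨ ∙-congˡ (\\-leftDividesˡ y z) ⟩
    x \\ z                 ∎

  [x∙y]\\z≈y\\[x\\z] : ∀ x y z → (x ∙ y) \\ z ≈ y \\ (x \\ z)
  [x∙y]\\z≈y\\[x\\z] x y z = begin
    (x ∙ y) ⁻¹ ∙ z       ≈⟨ ∙-congʳ (⁻¹-anti-homo-∙ x y) ⟩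
    (y ⁻¹ ∙ x ⁻¹) ∙ z    ≈⟨ assoc (y ⁻¹) (x ⁻¹) z ⟩
    y \\ (x \\ z)        ∎

  x\\[y∙z]≈[y\\x]\\z : ∀ x y z → x \\ (y ∙ z) ≈ (y \\ x) \\ z
  x\\[y∙z]≈[y\\x]\\z x y z = begin
    x ⁻¹ ∙ (y ∙ z)       ≈⟨ assoc (x ⁻¹) y z ⟨
    (x \\ y) ∙ z         ≈⟨ ∙-congʳ (⁻¹-anti-homo-\\ y x) ⟨
    (y \\ x) \\ z        ∎

  _⊆_·_ : Subset → Subset → Subset → Set (c ⊔ ℓ)
  H ⊆ H′ · K = ∀ {h} → H h → ∃[ h′ ] (H′ h′ × InCoset h K h′)

  module _ {K : Subset} (K≤G : IsSubgroup K) where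
    open IsSubgroup K≤G

    coset-refl : ∀ x → InCoset x K x
    coset-refl x = resp (sym (inverseˡ x)) ε∈

    coset-sym : ∀ {x y} → InCoset x K y → InCoset y K x
    coset-sym y∈xK = resp (⁻¹-anti-homo-\\ _ _) (⁻¹∈ y∈xK)

    coset-trans : ∀ {x y z} → InCoset x K y → InCoset y K z → InCoset x K z
    coset-trans y∈xK z∈yK = resp ([x\\y]∙[y\\z]≈x\\z _ _ _) (∙∈ y∈xK z∈yK)

    coset-open : FiniteIndexIn K Full → ∀ x → IsOpen (InCoset x K)
    coset-open K-fi x z∈xK = K , (K≤G , K-fi) , coset-trans z∈xK

    ⊆·⇒coset-⊆· : ∀ {H H′} → RespectsEq H′ → H ⊆ H′ · K →
                  ∀ {x g} → InCoset x H g → ∃[ z ] (InCoset x H′ z × InCoset g K z)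
    ⊆·⇒coset-⊆· H′-resp H⊆H′K {x} {g} g∈xH with H⊆H′K g∈xH
    ... | h′ , h′∈H′ , h′∈hK =
      x ∙ h′ , H′-resp (sym (\\-leftDividesʳ x h′)) h′∈H′ , resp (sym (x\\[y∙z]≈[y\\x]\\z g x h′)) h′∈hK

  finiteIndex-trans : ∀ {K H} → IsSubgroup K → FiniteIndexIn K H → FiniteIndexIn H Full → FiniteIndexIn K Full
  finiteIndex-trans {K} K≤G (ks , _ , H⊆ksK) (hs , _ , G⊆hsH) =
    concatMap (λ r → map (r ∙_) ks) hs , universal _ _ ,
    λ _ → concatMap⁺ _ (Any.map (λ g∈rH → map⁺ (Any.map rk∋g (H⊆ksK g∈rH))) (G⊆hsH _))
    where
    rk∋g : ∀ {r g k} → InCoset k K (r \\ g) → InCoset (r ∙ k) K g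
    rk∋g = IsSubgroup.resp K≤G (sym ([x∙y]\\z≈y\\[x\\z] _ _ _))

module TreeProperties {c ℓ : Level} {G : Group c ℓ} (D : GroupDefs.TreeData G) where
  open Group G using (ε)
  open GroupDefs G using (InCoset; IsSubgroup; IsLeaf; Full; FiniteIndexIn; IsOpen; _⁀_)
  open GroupDefs.TreeData D
  open GroupDefs.IsFBTree isTree
  open Cosets G

  T-++⁻ˡ : ∀ ν ζ → T (ν ++ ζ) → T ν
  T-++⁻ˡ ν []      Tν  = ≡.subst T (++-identityʳ ν) Tν
  T-++⁻ˡ ν (i ∷ ζ) Tνζ = prefixClosed ν i (T-++⁻ˡ (ν ⁀ i) ζ (≡.subst T (≡.sym (++-assoc ν [ i ] ζ)) Tνζ))

  H-finiteIndex : ∀ {η} → T η → FiniteIndexIn (H η) Full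
  H-finiteIndex {η} = go (reverseView η)
    where
    go : ∀ {η} → Reverse η → T η → FiniteIndexIn (H η) Full
    go []             _   = [ ε ] , universal _ _ , λ _ → here (rootFull _)
    go (η ∶ r ∶ʳ i) Tηi = finiteIndex-trans (subgroup _ Tηi) (proj₁ (proj₂ (proj₂ (childProper η i Tηi))))
                                            (go r (prefixClosed η i Tηi))

  nodeCoset-open : ∀ {η} → T η → IsOpen (InCoset (d η) (H η))
  nodeCoset-open {η} Tη = coset-open (subgroup η Tη) (H-finiteIndex Tη) (d η)

  private
    not-leaf : ∀ {ν i} → T (ν ⁀ i) → ¬ IsLeaf T ν
    not-leaf {i = i} Tνi (_ , childless) = childless i Tνi

  childCoset⊆coset : ∀ {ν i x} → T (ν ⁀ i) → InCoset (d (ν ⁀ i)) (H (ν ⁀ i)) x → InCoset (d ν) (H ν) x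
  childCoset⊆coset {ν} {i} {x} Tνi = proj₂ (cover ν (prefixClosed ν i Tνi) (not-leaf Tνi) x) i Tνi

  coset-at-childRep : ∀ {ν i x} → T (ν ⁀ i) → InCoset (d ν) (H ν) x → InCoset (d (ν ⁀ i)) (H ν) x
  coset-at-childRep {ν} {i} Tνi x∈dH = coset-trans Hν≤G (coset-sym Hν≤G dνi∈dH) x∈dH
    where
    Hν≤G : IsSubgroup (H ν)
    Hν≤G = subgroup ν (prefixClosed ν i Tνi)

    dνi∈dH : InCoset (d ν) (H ν) (d (ν ⁀ i))
    dνi∈dH = childCoset⊆coset Tνi (coset-refl (subgroup _ Tνi) (d (ν ⁀ i)))

  coset⊆childCosets : ∀ {ν i x} → T (ν ⁀ i) → InCoset (d ν) (H ν) x →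
                      ∃[ j ] (T (ν ⁀ j) × InCoset (d (ν ⁀ j)) (H (ν ⁀ j)) x)
  coset⊆childCosets {ν} {i} {x} Tνi = proj₁ (cover ν (prefixClosed ν i Tνi) (not-leaf Tνi) x)

module Density {c ℓ : Level} {G : Group c ℓ} (D : GroupDefs.TreeData G)
               {K : GroupDefs.Subset G} (K≤G : GroupDefs.IsSubgroup G K)
               (K-fi : GroupDefs.FiniteIndexIn G K (GroupDefs.Full G)) (y : Group.Carrier G) where
  open Group G using (Carrier)
  open GroupDefs G using (InCoset; IsSubgroup; IsLeaf; Node; _⁀_)
  open GroupDefs.TreeData D
  open Cosets G
  open TreeProperties D

  private
    reps : List Carrier
    reps = proj₁ K-fi

    n : ℕ
    n = length reps

    K-cover : ∀ h → Any (λ r → InCoset r K h) reps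
    K-cover h = proj₂ (proj₂ K-fi) _

    representative : ∀ h → ∃[ q ] InCoset (lookup reps q) K h
    representative h = Any.index (K-cover h) , lookup-index (K-cover h)

  Meets : Node → Set (c ⊔ ℓ)
  Meets ν = ∃[ x ] (InCoset (d ν) (H ν) x × InCoset y K x)

  Hits : Node → Pred (Fin n) (c ⊔ ℓ)
  Hits ν q = ∃[ h ] (H ν h × InCoset (lookup reps q) K h)

  hits⇒⊆· : ∀ {ν ν′} → (∀ {q} → Hits ν q → Hits ν′ q) → H ν ⊆ H ν′ · K
  hits⇒⊆· Hν⊆Hν′ {h} h∈Hν with representative h
  ... | q , h∈rK with Hν⊆Hν′ (h , h∈Hν , h∈rK)
  ... | h′ , h′∈Hν′ , h′∈rK = h′ , h′∈Hν′ , coset-trans K≤G (coset-sym K≤G h∈rK) h′∈rK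

  hits-child : ∀ {ν i q} → T (ν ⁀ i) → Hits (ν ⁀ i) q → Hits ν q
  hits-child {ν} {i} Tνi (h , h∈Hνi , h∈rK) = h , proj₁ (proj₂ (childProper ν i Tνi)) h∈Hνi , h∈rK

  hits-sibling : ∀ {ν i j q} → T (ν ⁀ i) → T (ν ⁀ j) → Hits (ν ⁀ j) q → Hits (ν ⁀ i) q
  hits-sibling {ν} {i} {j} Tνi Tνj (h , h∈Hνj , h∈rK) = h , proj₂ (siblingsEq ν i j Tνi Tνj h) h∈Hνj , h∈rK

  meets-child : ∀ {ν i} → T (ν ⁀ i) → H ν ⊆ H (ν ⁀ i) · K → Meets ν → Meets (ν ⁀ i)
  meets-child Tνi Hν⊆HνiK (x , x∈dHν , x∈yK)
    with ⊆·⇒coset-⊆· K≤G (IsSubgroup.resp (subgroup _ Tνi)) Hν⊆HνiK (coset-at-childRep Tνi x∈dHν)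
  ... | z , z∈dHνi , z∈xK = z , z∈dHνi , coset-trans K≤G x∈yK z∈xK

  Live : FinSubset.Subset n → Node → Set (c ⊔ ℓ)
  Live s ν = T ν × s Represents Hits ν × Meets ν

  Advance : FinSubset.Subset n → Node → ℕ → Set (c ⊔ ℓ)
  Advance s ν i = (∃[ j ] ∃[ s′ ] (s′ ⊂ s × Live s′ (ν ⁀ j))) ⊎ Live s (ν ⁀ i)

  descent-step : ∀ {s ν i} → Live s ν → T (ν ⁀ i) → ¬ ¬ Advance s ν i
  descent-step {s} {ν} {i} (_ , s≐Hν , meets@(x , x∈dHν , x∈yK)) Tνi with coset⊆childCosets Tνi x∈dHν
  ... | j , Tνj , x∈dHνj = ¬¬-map compare (¬¬-represented (Hits (ν ⁀ j)))
    where
    compare : ∃[ s′ ] s′ Represents Hits (ν ⁀ j) → Advance s ν i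
    compare (s′ , s′≐Hνj) with ⊆⇒⊂⊎⊇ (from (s≐Hν _) ∘ hits-child Tνj ∘ to (s′≐Hνj _))
    ... | inj₁ s′⊂s = inj₁ (j , s′ , s′⊂s , Tνj , s′≐Hνj , x , x∈dHνj , x∈yK)
    ... | inj₂ s⊆s′ = inj₂ (Tνi , s≐Hνi , meets-child Tνi (hits⇒⊆· Hν⊆Hνi) meets)
      where
      Hν⊆Hνi : ∀ {q} → Hits ν q → Hits (ν ⁀ i) q
      Hν⊆Hνi = hits-sibling Tνi Tνj ∘ to (s′≐Hνj _) ∘ s⊆s′ ∘ from (s≐Hν _)

      s≐Hνi : s Represents Hits (ν ⁀ i)
      s≐Hνi q = mk⇔ (Hν⊆Hνi ∘ to (s≐Hν q)) (from (s≐Hν q) ∘ hits-child Tνi)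

  module _ (no-leaf-meets : ∀ η → IsLeaf T η → ¬ Meets η) where

    descend : ∀ {s ν} → Acc _⊂_ s → Live s ν → ∀ ζ → IsLeaf T (ν ++ ζ) → ⊥
    descend {s} (acc smaller) = towards
      where
      towards : ∀ {ν} → Live s ν → ∀ ζ → IsLeaf T (ν ++ ζ) → ⊥
      towards {ν} (_ , _ , meets) [] leaf = no-leaf-meets ν (≡.subst (IsLeaf T) (++-identityʳ ν) leaf) meets
      towards {ν} live (i ∷ ζ) leaf = descent-step live Tνi continue
        where
        leaf-νi : IsLeaf T ((ν ⁀ i) ++ ζ)
        leaf-νi = ≡.subst (IsLeaf T) (≡.sym (++-assoc ν [ i ] ζ)) leaf

        Tνi : T (ν ⁀ i)
        Tνi = T-++⁻ˡ (ν ⁀ i) ζ (proj₁ leaf-νi)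

        continue : Advance s ν i → ⊥
        continue (inj₁ (j , s′ , s′⊂s , live′@(Tνj , _))) =
          let ζ′ , leaf′ = toLeaf (ν ⁀ j) Tνj in descend (smaller s′⊂s) live′ ζ′ leaf′
        continue (inj₂ live′) = towards live′ ζ leaf-νi

  leafCosets-dense : ¬ (∀ η → IsLeaf T η → ¬ Meets η)
  leafCosets-dense no-leaf-meets = ¬¬-represented (Hits []) λ (s , s≐H[]) →
    let ζ , leaf = toLeaf [] root in
    descend no-leaf-meets (⊂-wellFounded s) (root , s≐H[] , y , rootFull _ , coset-refl K≤G y) ζ leaf
    where open GroupDefs.IsFBTree isTree using (root)

module BoundaryOfAlmostTreeFounded {c ℓ p : Level} {G : Group c ℓ} {A : Pred (Group.Carrier G) p}
                                   (A-atf : GroupDefs.AlmostTreeFounded G A) where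
  open GroupDefs G using (InCoset; IsLeaf; Boundary)
  open GroupDefs.TreeData (proj₁ A-atf)
  open TreeProperties (proj₁ A-atf)

  leafCoset∩boundary-empty : ∀ {η x} → IsLeaf T η → InCoset (d η) (H η) x → ¬ Boundary A x
  leafCoset∩boundary-empty {η} leaf x∈dH (x∉int-A , x∉int-∁A) with v η in vη
  ... | true  = x∉int-A (_ , nodeCoset-open (proj₁ leaf) , x∈dH ,
                         λ g∈dH → proj₂ (proj₂ A-atf η leaf _ g∈dH) vη)
  ... | false = x∉int-∁A (_ , nodeCoset-open (proj₁ leaf) , x∈dH ,
                          λ g∈dH g∈A → not-¬ vη (proj₁ (proj₂ A-atf η leaf _ g∈dH) g∈A))

proposition4p2 : ∀ {c ℓ p : Level} (G : Group c ℓ) (A : Pred (Group.Carrier G) p) →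
    GroupDefs.RespectsEq G A →
    GroupDefs.AlmostTreeFounded G A →
    GroupDefs.StrongBaire G A
proposition4p2 G A _ A-atf y (U , U-open , y∈U , U⊆∂A) with U-open y∈U
... | K , (K≤G , K-fi) , yK⊆U =
  leafCosets-dense λ η leaf (x , x∈dH , x∈yK) → leafCoset∩boundary-empty leaf x∈dH (U⊆∂A (yK⊆U x∈yK))
  where
  open Density (proj₁ A-atf) K≤G K-fi y using (leafCosets-dense)
  open BoundaryOfAlmostTreeFounded A-atf using (leafCoset∩boundary-empty)
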